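{- Let $X=\{x_0,x_1,\ldots,x_k\}\subseteq \mathbf{F}_q^d$. Then $X$ is spherical if and only if for all $c_0,c_1,\ldots,c_k\in \mathbf{F}_q$ with $\sum_{i=0}^k c_i=0$ and $\sum_{i=0}^k c_i x_i=0$, one also has $\sum_{i=0}^k c_i |x_i|^2=0$.
   Context: $\mathbf{F}_q$ is a finite field of odd characteristic, $|x|^2=x\cdot x=\sum_j x_j^2$. A set $X$ is spherical if there exist $z\in\mathbf{F}_q^d$ and $r\in\mathbf{F}_q$ with $|x-z|^2=r$ for all $x\in X$. -}

module Defs where

open import Level using (Level; _⊔_) renaming (suc to lsuc)
open import Data.Nat using (ℕ; zero; suc)
open import Data.Fin using (Fin; zero; suc)
open import Data.List using (List)
open import Data.List.Membership.Setoid using ()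
open import Data.List.Relation.Unary.Any using (Any)
open import Data.Product using (Σ; ∃; ∃-syntax; _×_)
open import Relation.Nullary using (¬_)
open import Relation.Binary.Definitions using (Decidable)
open import Algebra.Bundles using (CommutativeRing)

-- A finite field of odd characteristic, as a record over a commutative ring
-- (setoid equality _≈_):
--   * nontrivial: 0 ≉ 1
--   * every nonzero element has a multiplicative inverse
--   * decidable equality (finite fields are discrete)
--   * finite: a list enumerating all elements up to ≈
--   * odd characteristic: 1 + 1 ≉ 0 (for a field, char ≠ 2 ⇔ 2 ≠ 0;
--     a finite field has prime characteristic, so char ≠ 2 ⇔ odd char)
record OddFiniteField (c ℓ : Level) : Set (lsuc (c ⊔ ℓ)) where
  field
    commRing : CommutativeRing c ℓ
  open CommutativeRing commRing public
  field
    0≉1      : ¬ (0# ≈ 1#)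
    inverse  : ∀ x → ¬ (x ≈ 0#) → ∃[ y ] (x * y ≈ 1#)
    _≟_      : Decidable _≈_
    elements : List Carrier
    complete : ∀ x → Any (x ≈_) elements
    odd-char : ¬ (1# + 1# ≈ 0#)

module _ {c ℓ : Level} (F : OddFiniteField c ℓ) where
  open OddFiniteField F using (Carrier; _≈_; _+_; _*_; _-_; 0#)

  ∑ : ∀ {n} → (Fin n → Carrier) → Carrier
  ∑ {zero}  f = 0#
  ∑ {suc n} f = f zero + ∑ (λ i → f (suc i))

  dot : ∀ {d} → (Fin d → Carrier) → (Fin d → Carrier) → Carrier
  dot x y = ∑ (λ j → x j * y j)

  ∣_∣² : ∀ {d} → (Fin d → Carrier) → Carrier
  ∣ x ∣² = dot x x

  _⊖_ : ∀ {d} → (Fin d → Carrier) → (Fin d → Carrier) → (Fin d → Carrier)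
  (x ⊖ y) j = x j - y j

  _≈ᵛ_ : ∀ {d} → (Fin d → Carrier) → (Fin d → Carrier) → Set ℓ
  x ≈ᵛ y = ∀ j → x j ≈ y j

  Spherical : ∀ {d n} → (Fin n → Fin d → Carrier) → Set (c ⊔ ℓ)
  Spherical {d} x = ∃[ z ] ∃[ r ] (∀ i → ∣ x i ⊖ z ∣² ≈ r)

-- Expanding |x − z|² = |x|² − 2 x·z + |z|² shows that the points lie on a sphere exactly
-- when i ↦ |x_i|² is the restriction of an affine function to the points, i.e. lies in
-- the row space of the matrix with rows (1, …, 1) and (x_{0j}, …, x_{kj}) for j < d; the
-- centre is half of the linear part, which needs odd characteristic. The condition of
-- the theorem says that this vector vanishes on the kernel of that matrix, and over a
-- field the annihilator of the kernel is the row space (Gaussian elimination on the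
-- first column, by induction on the number of columns).
module Submission where

open import Level using (Level; _⊔_)
open import Data.Nat as ℕ using (ℕ; zero; suc)
import Data.Nat.Properties as ℕₚ
open import Data.Integer as Int using (ℤ; -[1+_]; _◃_; sign; ∣_∣)
import Data.Integer.Properties as ℤₚ
open import Data.Sign as Sign using (Sign)
open import Data.Fin using (Fin; zero; suc)
open import Data.Fin.Properties using (all?; ¬∀⟶∃¬)
open import Data.Maybe using (just; nothing)
open import Data.Product using (∃-syntax; _,_; proj₁; proj₂)
open import Data.Vec.Functional using (Vector; _∷_; tail)
open import Function.Base using (_∘_)
open import Function.Bundles using (_⇔_; mk⇔)
open import Function.Construct.Composition using (_⇔-∘_)
open import Relation.Binary.Definitions using (WeaklyDecidable)
open import Relation.Binary.PropositionalEquality as ≡ using (_≡_; _≢_)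
open import Relation.Nullary using (¬_; yes; no)
open import Algebra.Bundles using (CommutativeRing)
open import Algebra.Solver.Ring.AlmostCommutativeRing
  using (fromCommutativeRing; _-Raw-AlmostCommutative⟶_)
import Algebra.Properties.AbelianGroup as AbelianGroupProperties
import Algebra.Properties.Ring as RingProperties
import Algebra.Properties.Semiring.Mult.TCOptimised as SemiringMult
import Algebra.Properties.Semiring.Sum as SemiringSum
import Algebra.Solver.CommutativeMonoid as CommutativeMonoidSolver
import Algebra.Solver.Ring as RingSolver
import Relation.Binary.Reasoning.Setoid as SetoidReasoning
open import Defs

-- The ring solver needs computable coefficients, so we use the canonical map ℤ → R.
module IntegerCoefficients {a ℓ : Level} (R : CommutativeRing a ℓ) where
  open CommutativeRing R
  open Int using (+_)
  open RingProperties ring using (-‿distribˡ-*; -‿distribʳ-*; -‿involutive; -0#≈0#)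
  open AbelianGroupProperties +-abelianGroup using (xyx⁻¹≈y; ⁻¹-∙-comm)
  open SemiringMult semiring using (_×_; 1+×; ×-homo-+; ×1-homo-*)
  open CommutativeMonoidSolver +-commutativeMonoid using (solve; _⊕_; _⊜_)
  open SetoidReasoning setoid

  ⟦_⟧ : ℤ → Carrier
  ⟦ + n ⟧      = n × 1#
  ⟦ -[1+ n ] ⟧ = - (suc n × 1#)

  1+x-[1+y]≈x-y : ∀ x y → (1# + x) - (1# + y) ≈ x - y
  1+x-[1+y]≈x-y x y = begin
    (1# + x) + - (1# + y)     ≈⟨ +-congˡ (⁻¹-∙-comm 1# y) ⟨
    (1# + x) + (- 1# + - y)   ≈⟨ solve 4 (λ o x o′ y → (o ⊕ x) ⊕ (o′ ⊕ y) ⊜ (o ⊕ (x ⊕ y)) ⊕ o′)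
                                         refl 1# x (- 1#) (- y) ⟩
    1# + (x - y) + - 1#       ≈⟨ xyx⁻¹≈y 1# (x - y) ⟩
    x - y                     ∎

  ⊖-homo : ∀ m n → ⟦ m Int.⊖ n ⟧ ≈ m × 1# - n × 1#
  ⊖-homo m       zero    rewrite ℤₚ.⊖-≥ {m} {0} ℕ.z≤n =
    trans (sym (+-identityʳ _)) (+-congˡ (sym -0#≈0#))
  ⊖-homo zero    (suc n) = sym (+-identityˡ _)
  ⊖-homo (suc m) (suc n) rewrite ℤₚ.[1+m]⊖[1+n]≡m⊖n m n = begin
    ⟦ m Int.⊖ n ⟧                     ≈⟨ ⊖-homo m n ⟩
    m × 1# - n × 1#                   ≈⟨ 1+x-[1+y]≈x-y _ _ ⟨
    (1# + m × 1#) - (1# + n × 1#)     ≈⟨ +-cong (1+× m 1#) (-‿cong (1+× n 1#)) ⟨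
    suc m × 1# - suc n × 1#           ∎

  +-homo : ∀ i j → ⟦ i Int.+ j ⟧ ≈ ⟦ i ⟧ + ⟦ j ⟧
  +-homo (+ m)      (+ n)      = ×-homo-+ 1# m n
  +-homo (+ m)      -[1+ n ]   = ⊖-homo m (suc n)
  +-homo -[1+ m ]   (+ n)      = trans (⊖-homo n (suc m)) (+-comm _ _)
  +-homo -[1+ m ]   -[1+ n ]   = begin
    - (suc (suc (m ℕ.+ n)) × 1#)          ≡⟨ ≡.cong (λ k → - (suc k × 1#)) (ℕₚ.+-suc m n) ⟨
    - ((suc m ℕ.+ suc n) × 1#)            ≈⟨ -‿cong (×-homo-+ 1# (suc m) (suc n)) ⟩
    - (suc m × 1# + suc n × 1#)           ≈⟨ ⁻¹-∙-comm _ _ ⟨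
    - (suc m × 1#) + - (suc n × 1#)       ∎

  -‿homo : ∀ i → ⟦ Int.- i ⟧ ≈ - ⟦ i ⟧
  -‿homo (+ zero)  = sym -0#≈0#
  -‿homo (+ suc n) = refl
  -‿homo -[1+ n ]  = sym (-‿involutive _)

  signed : Sign → Carrier → Carrier
  signed Sign.+ x = x
  signed Sign.- x = - x

  signed-cong : ∀ s {x y} → x ≈ y → signed s x ≈ signed s y
  signed-cong Sign.+ x≈y = x≈y
  signed-cong Sign.- x≈y = -‿cong x≈y

  ◃-homo : ∀ s n → ⟦ s ◃ n ⟧ ≈ signed s (n × 1#)
  ◃-homo Sign.+ n rewrite ℤₚ.+◃n≡+n n = refl
  ◃-homo Sign.- n rewrite ℤₚ.-◃n≡-n n = -‿homo (+ n)

  sign◃∣∣-homo : ∀ i → ⟦ i ⟧ ≈ signed (sign i) (∣ i ∣ × 1#)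
  sign◃∣∣-homo (+ n)    = refl
  sign◃∣∣-homo -[1+ n ] = refl

  signed-* : ∀ s t x y → signed (s Sign.* t) (x * y) ≈ signed s x * signed t y
  signed-* Sign.+ Sign.+ x y = refl
  signed-* Sign.+ Sign.- x y = -‿distribʳ-* x y
  signed-* Sign.- Sign.+ x y = -‿distribˡ-* x y
  signed-* Sign.- Sign.- x y = begin
    x * y         ≈⟨ -‿involutive _ ⟨
    - - (x * y)   ≈⟨ -‿cong (-‿distribˡ-* x y) ⟩
    - (- x * y)   ≈⟨ -‿distribʳ-* _ _ ⟩
    - x * - y     ∎

  *-homo : ∀ i j → ⟦ i Int.* j ⟧ ≈ ⟦ i ⟧ * ⟦ j ⟧
  *-homo i j = begin
    ⟦ (s Sign.* t) ◃ (∣ i ∣ ℕ.* ∣ j ∣) ⟧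
      ≈⟨ ◃-homo (s Sign.* t) (∣ i ∣ ℕ.* ∣ j ∣) ⟩
    signed (s Sign.* t) ((∣ i ∣ ℕ.* ∣ j ∣) × 1#)
      ≈⟨ signed-cong (s Sign.* t) (×1-homo-* ∣ i ∣ ∣ j ∣) ⟩
    signed (s Sign.* t) ((∣ i ∣ × 1#) * (∣ j ∣ × 1#))
      ≈⟨ signed-* s t (∣ i ∣ × 1#) (∣ j ∣ × 1#) ⟩
    signed s (∣ i ∣ × 1#) * signed t (∣ j ∣ × 1#)
      ≈⟨ *-cong (sign◃∣∣-homo i) (sign◃∣∣-homo j) ⟨
    ⟦ i ⟧ * ⟦ j ⟧ ∎
    where
    s t : Sign
    s = sign i
    t = sign j

  morphism : Int.+-*-rawRing -Raw-AlmostCommutative⟶ fromCommutativeRing R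
  morphism = record
    { ⟦_⟧    = ⟦_⟧
    ; +-homo = +-homo
    ; *-homo = *-homo
    ; -‿homo = -‿homo
    ; 0-homo = refl
    ; 1-homo = refl
    }

  _≟ᶜ_ : WeaklyDecidable (λ i j → ⟦ i ⟧ ≈ ⟦ j ⟧)
  i ≟ᶜ j with i Int.≟ j
  ... | yes ≡.refl = just refl
  ... | no _       = nothing

module IntegerRingSolver {a ℓ : Level} (R : CommutativeRing a ℓ) =
  RingSolver Int.+-*-rawRing (fromCommutativeRing R)
    (IntegerCoefficients.morphism R) (IntegerCoefficients._≟ᶜ_ R)

module _ {a ℓ : Level} (F : OddFiniteField a ℓ) where
  open OddFiniteField F hiding (zero)
  open SetoidReasoning setoid
  open IntegerRingSolver commRing using (solve; con; _:+_; _:-_; _:*_; :-_; _:=_)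
  private module Sum = SemiringSum semiring

  private
    variable
      m n d k : ℕ

  _·_ : Vector Carrier n → Vector Carrier n → Carrier
  _·_ = dot F

  ‖_‖² : Vector Carrier n → Carrier
  ‖_‖² = ∣_∣² F

  ∑≡sum : (f : Vector Carrier n) → ∑ F f ≡ Sum.sum f
  ∑≡sum {zero}  f = ≡.refl
  ∑≡sum {suc n} f = ≡.cong (f zero +_) (∑≡sum (f ∘ suc))

  ∑-cong : {f g : Vector Carrier n} → (∀ i → f i ≈ g i) → ∑ F f ≈ ∑ F g
  ∑-cong {f = f} {g} f≈g rewrite ∑≡sum f | ∑≡sum g = Sum.sum-cong-≋ f≈g

  ∑-zero : {f : Vector Carrier n} → (∀ i → f i ≈ 0#) → ∑ F f ≈ 0#
  ∑-zero {n} {f} f≈0 = begin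
    ∑ F f                       ≈⟨ ∑-cong f≈0 ⟩
    ∑ F {n} (λ _ → 0#)          ≡⟨ ∑≡sum {n} (λ _ → 0#) ⟩
    Sum.sum {n} (λ _ → 0#)      ≈⟨ Sum.sum-replicate-zero n ⟩
    0#                          ∎

  ∑-distrib-+ : (f g : Vector Carrier n) → ∑ F (λ i → f i + g i) ≈ ∑ F f + ∑ F g
  ∑-distrib-+ f g rewrite ∑≡sum (λ i → f i + g i) | ∑≡sum f | ∑≡sum g =
    Sum.∑-distrib-+ f g

  *-distribˡ-∑ : ∀ x (f : Vector Carrier n) → x * ∑ F f ≈ ∑ F (λ i → x * f i)
  *-distribˡ-∑ x f rewrite ∑≡sum f | ∑≡sum (λ i → x * f i) = Sum.*-distribˡ-sum x f

  ∑-comm : (f : Fin m → Fin n → Carrier) →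
           ∑ F (λ i → ∑ F (f i)) ≈ ∑ F (λ j → ∑ F (λ i → f i j))
  ∑-comm f = begin
    ∑ F (λ i → ∑ F (f i))               ≡⟨ ∑≡sum (λ i → ∑ F (f i)) ⟩
    Sum.sum (λ i → ∑ F (f i))           ≡⟨ Sum.sum-cong-≗ (λ i → ∑≡sum (f i)) ⟩
    Sum.sum (λ i → Sum.sum (f i))       ≈⟨ Sum.∑-comm f ⟩
    Sum.sum (λ j → Sum.sum (λ i → f i j)) ≡⟨ Sum.sum-cong-≗ (λ j → ∑≡sum (λ i → f i j)) ⟨
    Sum.sum (λ j → ∑ F (λ i → f i j))   ≡⟨ ∑≡sum (λ j → ∑ F (λ i → f i j)) ⟨
    ∑ F (λ j → ∑ F (λ i → f i j))       ∎

  unit : Fin n → Vector Carrier n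
  unit zero    zero    = 1#
  unit zero    (suc _) = 0#
  unit (suc _) zero    = 0#
  unit (suc r) (suc s) = unit r s

  ∑-unit-* : ∀ (r : Fin n) (f : Vector Carrier n) → ∑ F (λ s → unit r s * f s) ≈ f r
  ∑-unit-* {suc n} zero f = begin
    1# * f zero + ∑ F (λ s → 0# * f (suc s))
      ≈⟨ +-cong (*-identityˡ (f zero)) (∑-zero (λ s → zeroˡ (f (suc s)))) ⟩
    f zero + 0#
      ≈⟨ +-identityʳ (f zero) ⟩
    f zero ∎
  ∑-unit-* (suc r) f = begin
    0# * f zero + ∑ F (λ s → unit r s * f (suc s))
      ≈⟨ +-cong (zeroˡ (f zero)) (∑-unit-* r (f ∘ suc)) ⟩
    0# + f (suc r)
      ≈⟨ +-identityˡ (f (suc r)) ⟩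
    f (suc r) ∎

  lincomb : Vector Carrier m → (Fin m → Vector Carrier n) → Vector Carrier n
  lincomb l A i = ∑ F (λ r → l r * A r i)

  InRowSpace : (Fin m → Vector Carrier n) → Vector Carrier n → Set (a ⊔ ℓ)
  InRowSpace A w = ∃[ l ] (∀ i → w i ≈ lincomb l A i)

  InKernel : (Fin m → Vector Carrier n) → Vector Carrier n → Set ℓ
  InKernel A c = ∀ r → c · A r ≈ 0#

  VanishesOnKernel : (Fin m → Vector Carrier n) → Vector Carrier n → Set (a ⊔ ℓ)
  VanishesOnKernel A w = ∀ c → InKernel A c → c · w ≈ 0#

  ·-lincomb : ∀ c l (A : Fin m → Vector Carrier n) → c · lincomb l A ≈ l · (λ r → c · A r)
  ·-lincomb c l A = begin
    ∑ F (λ i → c i * ∑ F (λ r → l r * A r i))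
      ≈⟨ ∑-cong (λ i → *-distribˡ-∑ (c i) (λ r → l r * A r i)) ⟩
    ∑ F (λ i → ∑ F (λ r → c i * (l r * A r i)))
      ≈⟨ ∑-cong (λ i → ∑-cong (λ r → swap (c i) (l r) (A r i))) ⟩
    ∑ F (λ i → ∑ F (λ r → l r * (c i * A r i)))
      ≈⟨ ∑-comm (λ i r → l r * (c i * A r i)) ⟩
    ∑ F (λ r → ∑ F (λ i → l r * (c i * A r i)))
      ≈⟨ ∑-cong (λ r → *-distribˡ-∑ (l r) (λ i → c i * A r i)) ⟨
    ∑ F (λ r → l r * (c · A r)) ∎
    where
    swap : ∀ x y z → x * (y * z) ≈ y * (x * z)
    swap = solve 3 (λ x y z → x :* (y :* z) := y :* (x :* z)) refl

  inRowSpace⇒vanishesOnKernel : (A : Fin m → Vector Carrier n) (w : Vector Carrier n) →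
                                InRowSpace A w → VanishesOnKernel A w
  inRowSpace⇒vanishesOnKernel A w (l , w≈) c cA = begin
    c · w                   ≈⟨ ∑-cong (λ i → *-congˡ (w≈ i)) ⟩
    c · lincomb l A         ≈⟨ ·-lincomb c l A ⟩
    l · (λ r → c · A r)     ≈⟨ ∑-cong (λ r → *-congˡ (cA r)) ⟩
    l · (λ _ → 0#)          ≈⟨ ∑-zero (λ r → zeroʳ (l r)) ⟩
    0#                      ∎

  vanishesOnKernel-adjoint : (R : Vector Carrier n → Vector Carrier m)
                             (E : Vector Carrier m → Vector Carrier n) →
                             (∀ c u → E c · u ≈ c · R u) →
                             ∀ {k} {A : Fin k → Vector Carrier n} {w} →
                             VanishesOnKernel A w → VanishesOnKernel (R ∘ A) (R w)
  vanishesOnKernel-adjoint R E adjoint {A = A} {w} hyp c cRA =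
    trans (sym (adjoint c w)) (hyp (E c) (λ r → trans (adjoint c (A r)) (cRA r)))

  lincomb-+unit : ∀ l μ (r₀ : Fin m) (A : Fin m → Vector Carrier n) i →
                  lincomb (λ r → l r + μ * unit r₀ r) A i ≈ lincomb l A i + μ * A r₀ i
  lincomb-+unit l μ r₀ A i = begin
    ∑ F (λ r → (l r + μ * unit r₀ r) * A r i)
      ≈⟨ ∑-cong (λ r → expand (l r) μ (unit r₀ r) (A r i)) ⟩
    ∑ F (λ r → l r * A r i + μ * (unit r₀ r * A r i))
      ≈⟨ ∑-distrib-+ (λ r → l r * A r i) (λ r → μ * (unit r₀ r * A r i)) ⟩
    lincomb l A i + ∑ F (λ r → μ * (unit r₀ r * A r i))
      ≈⟨ +-congˡ (*-distribˡ-∑ μ (λ r → unit r₀ r * A r i)) ⟨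
    lincomb l A i + μ * ∑ F (λ r → unit r₀ r * A r i)
      ≈⟨ +-congˡ (*-congˡ (∑-unit-* r₀ (λ r → A r i))) ⟩
    lincomb l A i + μ * A r₀ i ∎
    where
    expand : ∀ x μ e y → (x + μ * e) * y ≈ x * y + μ * (e * y)
    expand = solve 4 (λ x μ e y → (x :+ μ :* e) :* y := x :* y :+ μ :* (e :* y)) refl

  VanishesOnKernel⇒InRowSpace : ℕ → ℕ → Set (a ⊔ ℓ)
  VanishesOnKernel⇒InRowSpace m n =
    (A : Fin m → Vector Carrier n) (w : Vector Carrier n) → VanishesOnKernel A w → InRowSpace A w

  0∷-· : (c : Vector Carrier n) (u : Vector Carrier (suc n)) → (0# ∷ c) · u ≈ c · tail u
  0∷-· c u = trans (+-congʳ (zeroˡ _)) (+-identityˡ _)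

  inRowSpace-zeroColumn : VanishesOnKernel⇒InRowSpace m n →
                          (A : Fin m → Vector Carrier (suc n)) (w : Vector Carrier (suc n)) →
                          (∀ r → A r zero ≈ 0#) → VanishesOnKernel A w → InRowSpace A w
  inRowSpace-zeroColumn IH A w col≈0 hyp = l , w≈
    where
    IH-tail : InRowSpace (tail ∘ A) (tail w)
    IH-tail = IH (tail ∘ A) (tail w) (vanishesOnKernel-adjoint tail (0# ∷_) 0∷-· {A = A} {w} hyp)
    l : Vector Carrier _
    l = proj₁ IH-tail
    w₀≈0 : w zero ≈ 0#
    w₀≈0 = trans (sym (∑-unit-* zero w))
                 (hyp (unit zero) (λ r → trans (∑-unit-* zero (A r)) (col≈0 r)))
    w≈ : ∀ i → w i ≈ lincomb l A i
    w≈ zero    = trans w₀≈0 (sym (∑-zero (λ r → trans (*-congˡ (col≈0 r)) (zeroʳ _))))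
    w≈ (suc i) = proj₂ IH-tail i

  module Elimination (p : Vector Carrier (suc n)) (a⁻¹ : Carrier) (p₀a⁻¹≈1 : p zero * a⁻¹ ≈ 1#)
    where

    reduce : Vector Carrier (suc n) → Vector Carrier n
    reduce u i = u (suc i) - (u zero * a⁻¹) * p (suc i)

    extend : Vector Carrier n → Vector Carrier (suc n)
    extend c = - (a⁻¹ * (c · tail p)) ∷ c

    extend-· : ∀ c u → extend c · u ≈ c · reduce u
    extend-· c u = begin
      - (a⁻¹ * (c · tail p)) * u zero + c · tail u
        ≈⟨ solve 4 (λ a⁻¹ s u₀ t → (:- (a⁻¹ :* s)) :* u₀ :+ t := t :+ (:- (u₀ :* a⁻¹)) :* s)
                 refl a⁻¹ (c · tail p) (u zero) (c · tail u) ⟩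
      c · tail u + κ * (c · tail p)
        ≈⟨ +-congˡ (*-distribˡ-∑ κ (λ i → c i * p (suc i))) ⟩
      c · tail u + ∑ F (λ i → κ * (c i * p (suc i)))
        ≈⟨ ∑-distrib-+ (λ i → c i * u (suc i)) (λ i → κ * (c i * p (suc i))) ⟨
      ∑ F (λ i → c i * u (suc i) + κ * (c i * p (suc i)))
        ≈⟨ ∑-cong (λ i → solve 5 (λ u₀ a⁻¹ c u′ b → c :* u′ :+ (:- (u₀ :* a⁻¹)) :* (c :* b)
                                                   := c :* (u′ :- (u₀ :* a⁻¹) :* b))
                                refl (u zero) a⁻¹ (c i) (u (suc i)) (p (suc i))) ⟩
      c · reduce u ∎
      where
      κ : Carrier
      κ = - (u zero * a⁻¹)

    reduce-lincomb : ∀ {m} l (A : Fin m → Vector Carrier (suc n)) i →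
                     reduce (lincomb l A) i ≈ lincomb l (reduce ∘ A) i
    reduce-lincomb l A i = begin
      lincomb l A (suc i) - (lincomb l A zero * a⁻¹) * b
        ≈⟨ solve 4 (λ s t a⁻¹ b → s :- (t :* a⁻¹) :* b := s :+ (:- (a⁻¹ :* b)) :* t)
                 refl (lincomb l A (suc i)) (lincomb l A zero) a⁻¹ b ⟩
      lincomb l A (suc i) + κ * lincomb l A zero
        ≈⟨ +-congˡ (*-distribˡ-∑ κ (λ r → l r * A r zero)) ⟩
      lincomb l A (suc i) + ∑ F (λ r → κ * (l r * A r zero))
        ≈⟨ ∑-distrib-+ (λ r → l r * A r (suc i)) (λ r → κ * (l r * A r zero)) ⟨
      ∑ F (λ r → l r * A r (suc i) + κ * (l r * A r zero))
        ≈⟨ ∑-cong (λ r → solve 5 (λ l x x₀ a⁻¹ b → l :* x :+ (:- (a⁻¹ :* b)) :* (l :* x₀)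
                                                   := l :* (x :- (x₀ :* a⁻¹) :* b))
                                refl (l r) (A r (suc i)) (A r zero) a⁻¹ b) ⟩
      lincomb l (reduce ∘ A) i ∎
      where
      b κ : Carrier
      b = p (suc i)
      κ = - (a⁻¹ * b)

    -- The kernel of reduce is spanned by p.
    reduce-≈⇒ : ∀ u v → (∀ i → reduce u i ≈ reduce v i) →
                ∀ i → u i ≈ v i + ((u zero - v zero) * a⁻¹) * p i
    reduce-≈⇒ u v _ zero = begin
      u zero
        ≈⟨ solve 2 (λ u₀ v₀ → u₀ := v₀ :+ (u₀ :- v₀)) refl (u zero) (v zero) ⟩
      v zero + (u zero - v zero)
        ≈⟨ +-congˡ (*-identityʳ (u zero - v zero)) ⟨
      v zero + (u zero - v zero) * 1#
        ≈⟨ +-congˡ (*-congˡ p₀a⁻¹≈1) ⟨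
      v zero + (u zero - v zero) * (p zero * a⁻¹)
        ≈⟨ solve 4 (λ u₀ v₀ p₀ a⁻¹ → v₀ :+ (u₀ :- v₀) :* (p₀ :* a⁻¹)
                                     := v₀ :+ ((u₀ :- v₀) :* a⁻¹) :* p₀)
                   refl (u zero) (v zero) (p zero) a⁻¹ ⟩
      v zero + ((u zero - v zero) * a⁻¹) * p zero ∎
    reduce-≈⇒ u v reduce≈ (suc i) = begin
      u (suc i)
        ≈⟨ solve 4 (λ u′ u₀ a⁻¹ b → u′ := (u′ :- (u₀ :* a⁻¹) :* b) :+ (u₀ :* a⁻¹) :* b)
                   refl (u (suc i)) (u zero) a⁻¹ b ⟩
      reduce u i + (u zero * a⁻¹) * b
        ≈⟨ +-congʳ (reduce≈ i) ⟩
      reduce v i + (u zero * a⁻¹) * b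
        ≈⟨ solve 5 (λ v′ v₀ u₀ a⁻¹ b → (v′ :- (v₀ :* a⁻¹) :* b) :+ (u₀ :* a⁻¹) :* b
                                       := v′ :+ ((u₀ :- v₀) :* a⁻¹) :* b)
                   refl (v (suc i)) (v zero) (u zero) a⁻¹ b ⟩
      v (suc i) + ((u zero - v zero) * a⁻¹) * b ∎
      where
      b : Carrier
      b = p (suc i)

  inRowSpace-pivot : VanishesOnKernel⇒InRowSpace m n →
                     (A : Fin m → Vector Carrier (suc n)) (w : Vector Carrier (suc n)) →
                     ∃[ r ] ¬ A r zero ≈ 0# → VanishesOnKernel A w → InRowSpace A w
  inRowSpace-pivot IH A w (r₀ , a≉0) hyp = (λ r → l r + μ * unit r₀ r) , w≈
    where
    a⁻¹ : Carrier
    a⁻¹ = proj₁ (inverse (A r₀ zero) a≉0)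
    open Elimination (A r₀) a⁻¹ (proj₂ (inverse (A r₀ zero) a≉0))
    IH-reduced : InRowSpace (reduce ∘ A) (reduce w)
    IH-reduced = IH (reduce ∘ A) (reduce w)
                    (vanishesOnKernel-adjoint reduce extend extend-· {A = A} {w} hyp)
    l : Vector Carrier _
    l = proj₁ IH-reduced
    μ : Carrier
    μ = (w zero - lincomb l A zero) * a⁻¹
    reduce-w≈ : ∀ j → reduce w j ≈ reduce (lincomb l A) j
    reduce-w≈ j = trans (proj₂ IH-reduced j) (sym (reduce-lincomb l A j))
    w≈ : ∀ i → w i ≈ lincomb (λ r → l r + μ * unit r₀ r) A i
    w≈ i = begin
      w i                                     ≈⟨ reduce-≈⇒ w (lincomb l A) reduce-w≈ i ⟩
      lincomb l A i + μ * A r₀ i              ≈⟨ lincomb-+unit l μ r₀ A i ⟨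
      lincomb (λ r → l r + μ * unit r₀ r) A i ∎

  vanishesOnKernel⇒inRowSpace : ∀ n → VanishesOnKernel⇒InRowSpace m n
  vanishesOnKernel⇒inRowSpace zero    A w _ = (λ _ → 0#) , λ ()
  vanishesOnKernel⇒inRowSpace {m} (suc n) A w hyp with all? (λ r → A r zero ≟ 0#)
  ... | yes col≈0 = inRowSpace-zeroColumn (vanishesOnKernel⇒inRowSpace n) A w col≈0 hyp
  ... | no  col≉0 = inRowSpace-pivot (vanishesOnKernel⇒inRowSpace n) A w
                      (¬∀⟶∃¬ m _ (λ r → A r zero ≟ 0#) col≉0) hyp

  inRowSpace⇔vanishesOnKernel : (A : Fin m → Vector Carrier n) (w : Vector Carrier n) →
                                InRowSpace A w ⇔ VanishesOnKernel A w
  inRowSpace⇔vanishesOnKernel {n = n} A w =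
    mk⇔ (inRowSpace⇒vanishesOnKernel A w) (vanishesOnKernel⇒inRowSpace n A w)

  _-ᵛ_ : Vector Carrier n → Vector Carrier n → Vector Carrier n
  _-ᵛ_ = _⊖_ F

  ‖-‖²-expand : (x z : Vector Carrier d) →
                ‖ x -ᵛ z ‖² + ∑ F (λ j → (z j + z j) * x j) ≈ ‖ x ‖² + ‖ z ‖²
  ‖-‖²-expand x z = begin
    ‖ x -ᵛ z ‖² + ∑ F (λ j → (z j + z j) * x j)
      ≈⟨ ∑-distrib-+ (λ j → (x j - z j) * (x j - z j)) (λ j → (z j + z j) * x j) ⟨
    ∑ F (λ j → (x j - z j) * (x j - z j) + (z j + z j) * x j)
      ≈⟨ ∑-cong (λ j → solve 2 (λ x z → (x :- z) :* (x :- z) :+ (z :+ z) :* x := x :* x :+ z :* z)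
                                refl (x j) (z j)) ⟩
    ∑ F (λ j → x j * x j + z j * z j)
      ≈⟨ ∑-distrib-+ (λ j → x j * x j) (λ j → z j * z j) ⟩
    ‖ x ‖² + ‖ z ‖² ∎

  affineRows : (Fin k → Vector Carrier d) → Fin (suc d) → Vector Carrier k
  affineRows x zero    i = 1#
  affineRows x (suc j) i = x i j

  spherical⇔inRowSpace : (x : Fin k → Vector Carrier d) →
                         Spherical F x ⇔ InRowSpace (affineRows x) (λ i → ‖ x i ‖²)
  spherical⇔inRowSpace {k} {d} x = mk⇔ to from
    where
    T : Vector Carrier d → Fin k → Carrier
    T z i = ∑ F (λ j → (z j + z j) * x i j)

    to : Spherical F x → InRowSpace (affineRows x) (λ i → ‖ x i ‖²)
    to (z , r , on-sphere) = (r - ‖ z ‖²) ∷ (λ j → z j + z j) , λ i → begin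
      ‖ x i ‖²
        ≈⟨ solve 2 (λ X Z → X := (X :+ Z) :- Z) refl ‖ x i ‖² ‖ z ‖² ⟩
      (‖ x i ‖² + ‖ z ‖²) - ‖ z ‖²
        ≈⟨ +-congʳ (‖-‖²-expand (x i) z) ⟨
      (‖ x i -ᵛ z ‖² + T z i) - ‖ z ‖²
        ≈⟨ +-congʳ (+-congʳ (on-sphere i)) ⟩
      (r + T z i) - ‖ z ‖²
        ≈⟨ solve 3 (λ r t Z → (r :+ t) :- Z := (r :- Z) :* con Int.1ℤ :+ t) refl r (T z i) ‖ z ‖² ⟩
      (r - ‖ z ‖²) * 1# + T z i ∎

    ½ : Carrier
    ½ = proj₁ (inverse (1# + 1#) odd-char)

    ½+½ : ∀ y → ½ * y + ½ * y ≈ y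
    ½+½ y = begin
      ½ * y + ½ * y
        ≈⟨ solve 2 (λ h y → h :* y :+ h :* y := ((con Int.1ℤ :+ con Int.1ℤ) :* h) :* y) refl ½ y ⟩
      ((1# + 1#) * ½) * y
        ≈⟨ *-congʳ (proj₂ (inverse (1# + 1#) odd-char)) ⟩
      1# * y
        ≈⟨ *-identityˡ y ⟩
      y ∎

    from : InRowSpace (affineRows x) (λ i → ‖ x i ‖²) → Spherical F x
    from (l , norm≈) = z , l zero + ‖ z ‖² , λ i → begin
      ‖ x i -ᵛ z ‖²
        ≈⟨ solve 2 (λ N t → N := (N :+ t) :- t) refl ‖ x i -ᵛ z ‖² (T z i) ⟩
      (‖ x i -ᵛ z ‖² + T z i) - T z i
        ≈⟨ +-congʳ (‖-‖²-expand (x i) z) ⟩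
      (‖ x i ‖² + ‖ z ‖²) - T z i
        ≈⟨ +-congʳ (+-congʳ (norm≈ i)) ⟩
      ((l zero * 1# + ∑ F (λ j → l (suc j) * x i j)) + ‖ z ‖²) - T z i
        ≈⟨ +-congʳ (+-congʳ (+-congˡ (∑-cong (λ j → *-congʳ (½+½ (l (suc j))))))) ⟨
      ((l zero * 1# + T z i) + ‖ z ‖²) - T z i
        ≈⟨ solve 3 (λ l₀ t Z → ((l₀ :* con Int.1ℤ :+ t) :+ Z) :- t := l₀ :+ Z)
                   refl (l zero) (T z i) ‖ z ‖² ⟩
      l zero + ‖ z ‖² ∎
      where
      z : Vector Carrier d
      z j = ½ * l (suc j)

  vanishesOnKernel-affineRows :
    (x : Fin k → Vector Carrier d) (w : Vector Carrier k) →
    VanishesOnKernel (affineRows x) w ⇔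
      (∀ cs → ∑ F cs ≈ 0# → (∀ j → ∑ F (λ i → cs i * x i j) ≈ 0#) → ∑ F (λ i → cs i * w i) ≈ 0#)
  vanishesOnKernel-affineRows x w = mk⇔
    (λ hyp cs ∑cs≈0 ∑csx≈0 → hyp cs (inKernel ∑cs≈0 ∑csx≈0))
    (λ cond c c∈ker → cond c (trans (sym (∑-*1 c)) (c∈ker zero)) (c∈ker ∘ suc))
    where
    ∑-*1 : ∀ c → ∑ F (λ i → c i * 1#) ≈ ∑ F c
    ∑-*1 c = ∑-cong (λ i → *-identityʳ (c i))
    inKernel : ∀ {cs} → ∑ F cs ≈ 0# → (∀ j → ∑ F (λ i → cs i * x i j) ≈ 0#) →
               InKernel (affineRows x) cs
    inKernel {cs} ∑cs≈0 _      zero    = trans (∑-*1 cs) ∑cs≈0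
    inKernel      _     ∑csx≈0 (suc j) = ∑csx≈0 j

open OddFiniteField using (Carrier; _≈_; _*_; 0#)

-- The points need not be distinct.
mainTheorem11 : ∀ {c ℓ} (F : OddFiniteField c ℓ) (d k : ℕ)
    (x : Fin (suc k) → Fin d → Carrier F) →
    (∀ i j → i ≢ j → ¬ (_≈ᵛ_ F (x i) (x j))) →
    Spherical F x ⇔
      (∀ (cs : Fin (suc k) → Carrier F) →
        _≈_ F (∑ F cs) (0# F) →
        (∀ j → _≈_ F (∑ F (λ i → _*_ F (cs i) (x i j))) (0# F)) →
        _≈_ F (∑ F (λ i → _*_ F (cs i) (∣_∣² F (x i)))) (0# F))
mainTheorem11 F d k x _ =
  vanishesOnKernel-affineRows F x norms
    ⇔-∘ (inRowSpace⇔vanishesOnKernel F (affineRows F x) norms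
    ⇔-∘ spherical⇔inRowSpace F x)
  where
  norms : Fin (suc k) → Carrier F
  norms i = ∣_∣² F (x i)
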